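{- Let $G=(V,E)$ be a subcubic graph and let $T$ be a spanning tree of $G$. Let $v\in V$ with $d_T(v)=3$, and suppose there is a neighbor $u$ of $v$ in $G$ with $d_T(u)=3$ such that $\{u,v\}$ is not a bridge of $G$. Then there is a spanning tree $T'$ of $G$ whose edge set contains $E(T)\setminus\{\{u,v\}\}$, with $|I(T')|\ge |I(T)|$ and $d_{T'}(u)=d_{T'}(v)=2$.
   Context: Graphs are simple and undirected; a graph is subcubic if its maximum degree is at most three. For a spanning tree $T$, $d_T(x)$ denotes the degree of $x$ in $T$ and $I(T)$ denotes the set of internal (non-leaf) vertices of $T$. A bridge is an edge whose removal disconnects the graph (increases the number of connected components). -}

module Defs where

open import Data.Nat using (ℕ; _≤_)
open import Data.Bool using (Bool; true; false)
open import Data.Fin using (Fin)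
open import Data.List using (List; []; _∷_; length; filterᵇ; allFin; last)
open import Data.List.Relation.Unary.Unique.Propositional using (Unique)
open import Data.List.Relation.Unary.Linked using (Linked)
open import Data.Maybe using (just)
open import Data.Product using (_×_; Σ; ∃)
open import Relation.Binary.PropositionalEquality using (_≡_; _≢_)
open import Relation.Nullary using (¬_)
import Data.Fin
import Data.Nat
import Data.Sum

record Graph (n : ℕ) : Set where
  field
    adj    : Fin n → Fin n → Bool
    sym    : ∀ x y → adj x y ≡ adj y x
    irrefl : ∀ x → adj x x ≡ false
open Graph public

module _ {n : ℕ} where

  deg : Graph n → Fin n → ℕ
  deg G x = length (filterᵇ (adj G x) (allFin n))

  Subcubic : Graph n → Set
  Subcubic G = ∀ x → deg G x ≤ 3

  data Walk (R : Fin n → Fin n → Bool) : Fin n → Fin n → Set where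
    here : ∀ {x} → Walk R x x
    step : ∀ {x y z} → R x y ≡ true → Walk R y z → Walk R x z

  Connected : Graph n → Set
  Connected G = ∀ x y → Walk (adj G) x y

  record Cycle (G : Graph n) : Set where
    field
      x₀ x₁ x₂ : Fin n
      rest     : List (Fin n)
      xₖ       : Fin n
      isLast   : last (x₀ ∷ x₁ ∷ x₂ ∷ rest) ≡ just xₖ
      distinct : Unique (x₀ ∷ x₁ ∷ x₂ ∷ rest)
      path     : Linked (λ a b → adj G a b ≡ true) (x₀ ∷ x₁ ∷ x₂ ∷ rest)
      closing  : adj G xₖ x₀ ≡ true

  Acyclic : Graph n → Set
  Acyclic G = ¬ Cycle G

  IsTree : Graph n → Set
  IsTree T = Connected T × Acyclic T

  _⊆E_ : Graph n → Graph n → Set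
  H ⊆E G = ∀ x y → adj H x y ≡ true → adj G x y ≡ true

  IsSpanningTree : Graph n → Graph n → Set
  IsSpanningTree G T = (T ⊆E G) × IsTree T

  adjWithout : Graph n → Fin n → Fin n → Fin n → Fin n → Bool
  adjWithout G u v x y with Data.Fin._≟_ x u | Data.Fin._≟_ y v | Data.Fin._≟_ x v | Data.Fin._≟_ y u
  ... | Relation.Nullary.yes _ | Relation.Nullary.yes _ | _ | _ = false
  ... | _ | _ | Relation.Nullary.yes _ | Relation.Nullary.yes _ = false
  ... | _ | _ | _ | _ = adj G x y

  -- {u,v} is a bridge of G: it is an edge of G and its removal disconnects
  -- u from v (equivalently, increases the number of components).
  IsBridge : Graph n → Fin n → Fin n → Set
  IsBridge G u v = (adj G u v ≡ true) × ¬ Walk (adjWithout G u v) u v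

  internalCount : Graph n → ℕ
  internalCount T = length (filterᵇ (λ x → Data.Nat._≤ᵇ_ 2 (deg T x)) (allFin n))

  ContainsAllBut : Graph n → Graph n → Fin n → Fin n → Set
  ContainsAllBut T T' u v =
    ∀ x y → adj T x y ≡ true → ¬ ((x ≡ u × y ≡ v) Data.Sum.⊎ (x ≡ v × y ≡ u)) →
      adj T' x y ≡ true

-- Since d_T(u) = d_T(v) = 3 and G is subcubic, every edge of G at u or at v is already an edge
-- of T. Deleting uv splits T into the side of u and the side of v; as uv is not a bridge, some
-- other edge xy of G joins the two sides, with x on the side of u. Neither x = u nor y = v is
-- possible, since the remaining edges at u and v are tree edges inside one side. Hence
-- T' = T - uv + xy is a spanning tree in which u and v lose exactly their common edge, while
-- every other vertex only gains edges, so no internal vertex of T becomes a leaf.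

module Submission where

open import Defs hiding (sym)
open import Data.Bool using (Bool; true; false; _∨_) renaming (_≟_ to _≟ᴮ_)
open import Data.Bool.Properties using (¬-not; ∨-zeroʳ; T-≡)
open import Data.Empty using (⊥-elim)
open import Data.Fin using (Fin; _≟_)
open import Data.Fin.Properties using (any?)
open import Data.List using (List; []; _∷_; length; filterᵇ; allFin; last)
open import Data.List.Membership.Propositional using (_∈_; _∉_)
open import Data.List.Membership.Propositional.Properties using (∈-allFin)
open import Data.List.Properties using (length-filter; length-tabulate)
open import Data.List.Relation.Unary.All as All using (All; []; _∷_)
open import Data.List.Relation.Unary.All.Properties using (All¬⇒¬Any)
open import Data.List.Relation.Unary.AllPairs using ([]; _∷_)
open import Data.List.Relation.Unary.Any using (here; there)
open import Data.List.Relation.Unary.Linked as Linked using (Linked; []; [-]; _∷_)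
open import Data.List.Relation.Unary.Unique.Propositional using (Unique)
open import Data.List.Relation.Unary.Unique.Propositional.Properties using (allFin⁺)
open import Data.Maybe using (just)
open import Data.Nat using (ℕ; zero; suc; _≤_; _<_; _≤ᵇ_; z≤n; s≤s)
open import Data.Nat.Properties
  using (≤-trans; ≤-reflexive; <⇒≱; ≤-<-trans; m≤n⇒m≤1+n; suc-injective; ≤ᵇ⇒≤; ≤⇒≤ᵇ)
open import Data.Product using (_×_; _,_; Σ; ∃; ∃₂; proj₁; proj₂)
open import Data.Sum using (_⊎_; inj₁; inj₂; [_,_]; [_,_]′)
open import Function using (_∘_; mk⇔; Equivalence)
open import Relation.Binary.PropositionalEquality
  using (_≡_; _≢_; refl; sym; trans; cong; subst)
open import Relation.Nullary using (¬_; Dec; yes; no; does; contradiction)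
open import Relation.Nullary.Decidable using (T?; _×-dec_; _⊎-dec_; ¬?; dec-true; dec-false; does-⇔)

does⇒ : {A : Set} (a? : Dec A) → does a? ≡ true → A
does⇒ (yes a) _ = a

Bool-ext : {a b : Bool} → (a ≡ true → b ≡ true) → (b ≡ true → a ≡ true) → a ≡ b
Bool-ext {true}  {true}  _ _ = refl
Bool-ext {true}  {false} f _ = sym (f refl)
Bool-ext {false} {true}  _ g = g refl
Bool-ext {false} {false} _ _ = refl

module _ {A : Set} where

  countᵇ : (A → Bool) → List A → ℕ
  countᵇ p xs = length (filterᵇ p xs)

  countᵇ-mono : {f g : A → Bool} → (∀ z → f z ≡ true → g z ≡ true) →
                ∀ xs → countᵇ f xs ≤ countᵇ g xs
  countᵇ-mono             f⇒g []       = z≤n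
  countᵇ-mono {f} {g} f⇒g (x ∷ xs) with f x in fx | g x in gx
  ... | true  | true  = s≤s (countᵇ-mono f⇒g xs)
  ... | true  | false = contradiction (trans (sym (f⇒g x fx)) gx) λ ()
  ... | false | true  = m≤n⇒m≤1+n (countᵇ-mono f⇒g xs)
  ... | false | false = countᵇ-mono f⇒g xs

  countᵇ-mono-< : {f g : A → Bool} → (∀ z → f z ≡ true → g z ≡ true) →
                  ∀ {a} → f a ≡ false → g a ≡ true →
                  ∀ {xs} → a ∈ xs → countᵇ f xs < countᵇ g xs
  countᵇ-mono-< f⇒g fa ga {x ∷ xs} (here refl) rewrite fa | ga = s≤s (countᵇ-mono f⇒g xs)
  countᵇ-mono-< {f} {g} f⇒g fa ga {x ∷ xs} (there a∈xs) with f x in fx | g x in gx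
  ... | true  | true  = s≤s (countᵇ-mono-< f⇒g fa ga a∈xs)
  ... | true  | false = contradiction (trans (sym (f⇒g x fx)) gx) λ ()
  ... | false | true  = m≤n⇒m≤1+n (countᵇ-mono-< f⇒g fa ga a∈xs)
  ... | false | false = countᵇ-mono-< f⇒g fa ga a∈xs

  countᵇ-cong : {f g : A → Bool} → ∀ xs → (∀ {z} → z ∈ xs → f z ≡ g z) →
                countᵇ f xs ≡ countᵇ g xs
  countᵇ-cong         []       _   = refl
  countᵇ-cong {f} {g} (x ∷ xs) f≗g rewrite f≗g (here refl) with g x
  ... | true  = cong suc (countᵇ-cong xs (f≗g ∘ there))
  ... | false = countᵇ-cong xs (f≗g ∘ there)

  countᵇ-insert : {f g : A → Bool} {a : A} → (∀ z → z ≢ a → f z ≡ g z) →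
                  f a ≡ false → g a ≡ true →
                  ∀ {xs} → Unique xs → a ∈ xs → countᵇ g xs ≡ suc (countᵇ f xs)
  countᵇ-insert f≗g fa ga {x ∷ xs} (x∉xs ∷ _) (here refl) rewrite fa | ga =
    cong suc (countᵇ-cong xs λ z∈xs → sym (f≗g _ λ { refl → All¬⇒¬Any x∉xs z∈xs }))
  countᵇ-insert {f} {g} f≗g fa ga {x ∷ xs} (x∉xs ∷ u) (there a∈xs)
    rewrite f≗g x (λ { refl → All¬⇒¬Any x∉xs a∈xs }) with g x
  ... | true  = cong suc (countᵇ-insert f≗g fa ga u a∈xs)
  ... | false = countᵇ-insert f≗g fa ga u a∈xs

module _ {n : ℕ} where

  SameEdge : Fin n → Fin n → Fin n → Fin n → Set
  SameEdge a b p q = (a ≡ p × b ≡ q) ⊎ (a ≡ q × b ≡ p)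

  sameEdge? : ∀ a b p q → Dec (SameEdge a b p q)
  sameEdge? a b p q = ((a ≟ p) ×-dec (b ≟ q)) ⊎-dec ((a ≟ q) ×-dec (b ≟ p))

  SameEdge-swap : ∀ {a b p q} → SameEdge a b p q → SameEdge b a p q
  SameEdge-swap (inj₁ (a≡p , b≡q)) = inj₂ (b≡q , a≡p)
  SameEdge-swap (inj₂ (a≡q , b≡p)) = inj₁ (b≡p , a≡q)

  SameEdge-other : ∀ {a b c p q} → SameEdge a b p q → SameEdge a c p q → b ≡ c
  SameEdge-other (inj₁ (refl , refl)) (inj₁ (_ , refl))   = refl
  SameEdge-other (inj₁ (refl , refl)) (inj₂ (a≡b , refl)) = sym a≡b
  SameEdge-other (inj₂ (refl , refl)) (inj₁ (a≡b , refl)) = sym a≡b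
  SameEdge-other (inj₂ (refl , refl)) (inj₂ (_ , refl))   = refl

  SameEdge-loop : ∀ {a p q} → p ≢ q → ¬ SameEdge a a p q
  SameEdge-loop p≢q (inj₁ (a≡p , a≡q)) = p≢q (trans (sym a≡p) a≡q)
  SameEdge-loop p≢q (inj₂ (a≡q , a≡p)) = p≢q (trans (sym a≡p) a≡q)

  removeEdge? : (G : Graph n) (p q a b : Fin n) → Dec (adj G a b ≡ true × ¬ SameEdge a b p q)
  removeEdge? G p q a b = (adj G a b ≟ᴮ true) ×-dec ¬? (sameEdge? a b p q)

  addEdge? : (G : Graph n) (p q a b : Fin n) → Dec (adj G a b ≡ true ⊎ SameEdge a b p q)
  addEdge? G p q a b = (adj G a b ≟ᴮ true) ⊎-dec sameEdge? a b p q

  removeEdge : Graph n → Fin n → Fin n → Graph n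
  removeEdge G p q = record
    { adj    = λ a b → does (removeEdge? G p q a b)
    ; sym    = λ a b → does-⇔ (mk⇔ swap swap) (removeEdge? G p q a b) (removeEdge? G p q b a)
    ; irrefl = λ a → dec-false (removeEdge? G p q a a) λ (loop , _) →
        contradiction (trans (sym (irrefl G a)) loop) λ ()
    }
    where
      swap : ∀ {a b} → adj G a b ≡ true × ¬ SameEdge a b p q → adj G b a ≡ true × ¬ SameEdge b a p q
      swap {a} {b} (ab , ¬ab) = trans (Graph.sym G b a) ab , ¬ab ∘ SameEdge-swap

  addEdge : (G : Graph n) (p q : Fin n) → p ≢ q → Graph n
  addEdge G p q p≢q = record
    { adj    = λ a b → does (addEdge? G p q a b)
    ; sym    = λ a b → does-⇔ (mk⇔ swap swap) (addEdge? G p q a b) (addEdge? G p q b a)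
    ; irrefl = λ a → dec-false (addEdge? G p q a a) λ
        { (inj₁ loop) → contradiction (trans (sym (irrefl G a)) loop) λ ()
        ; (inj₂ e)    → SameEdge-loop p≢q e }
    }
    where
      swap : ∀ {a b} → adj G a b ≡ true ⊎ SameEdge a b p q → adj G b a ≡ true ⊎ SameEdge b a p q
      swap {a} {b} (inj₁ ab) = inj₁ (trans (Graph.sym G b a) ab)
      swap         (inj₂ e)  = inj₂ (SameEdge-swap e)

  module _ (G : Graph n) (p q : Fin n) where

    removeEdge-⊆ : removeEdge G p q ⊆E G
    removeEdge-⊆ a b = proj₁ ∘ does⇒ (removeEdge? G p q a b)

    removeEdge-keeps : ∀ {a b} → adj G a b ≡ true → ¬ SameEdge a b p q →
                       adj (removeEdge G p q) a b ≡ true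
    removeEdge-keeps {a} {b} ab ¬e = dec-true (removeEdge? G p q a b) (ab , ¬e)

    removeEdge-removes : ∀ {a b} → SameEdge a b p q → adj (removeEdge G p q) a b ≡ false
    removeEdge-removes {a} {b} e = dec-false (removeEdge? G p q a b) λ (_ , ¬e) → ¬e e

    removeEdge-sound : ∀ {a b} → adj (removeEdge G p q) a b ≡ true → ¬ SameEdge a b p q
    removeEdge-sound {a} {b} = proj₂ ∘ does⇒ (removeEdge? G p q a b)

    module _ (p≢q : p ≢ q) where

      addEdge-⊇ : G ⊆E addEdge G p q p≢q
      addEdge-⊇ a b ab = dec-true (addEdge? G p q a b) (inj₁ ab)

      addEdge-adds : ∀ {a b} → SameEdge a b p q → adj (addEdge G p q p≢q) a b ≡ true
      addEdge-adds {a} {b} e = dec-true (addEdge? G p q a b) (inj₂ e)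

      addEdge-cases : ∀ {a b} → adj (addEdge G p q p≢q) a b ≡ true →
                      adj G a b ≡ true ⊎ SameEdge a b p q
      addEdge-cases {a} {b} = does⇒ (addEdge? G p q a b)

  deg-mono : {G H : Graph n} {a : Fin n} → (∀ z → adj H a z ≡ true → adj G a z ≡ true) →
             deg H a ≤ deg G a
  deg-mono H⇒G = countᵇ-mono H⇒G (allFin n)

  deg-saturated : {G H : Graph n} → H ⊆E G → ∀ {a} → deg G a ≤ deg H a →
                  ∀ {z} → adj G a z ≡ true → adj H a z ≡ true
  deg-saturated {G} {H} H⊆G {a} G≤H {z} az with adj H a z in hz
  ... | true  = refl
  ... | false = contradiction G≤H (<⇒≱ (countᵇ-mono-< (H⊆G a) hz az (∈-allFin z)))

  removeEdge-deg : {G : Graph n} {p q a b : Fin n} → adj G a b ≡ true → SameEdge a b p q →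
                   deg G a ≡ suc (deg (removeEdge G p q) a)
  removeEdge-deg {G} {p} {q} {a} {b} ab e =
    countᵇ-insert agree (removeEdge-removes G p q e) ab (allFin⁺ n) (∈-allFin b)
    where
      agree : ∀ z → z ≢ b → adj (removeEdge G p q) a z ≡ adj G a z
      agree z z≢b = Bool-ext (removeEdge-⊆ G p q a z) λ az →
        removeEdge-keeps G p q az λ e′ → z≢b (SameEdge-other e′ e)

  addEdge-deg-away : {G : Graph n} {p q a : Fin n} (p≢q : p ≢ q) → a ≢ p → a ≢ q →
                     deg (addEdge G p q p≢q) a ≡ deg G a
  addEdge-deg-away {G} {p} {q} {a} p≢q a≢p a≢q = countᵇ-cong (allFin n) λ {z} _ →
    Bool-ext (λ az → [ (λ az → az) , (⊥-elim ∘ away) ] (addEdge-cases G p q p≢q az))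
             (addEdge-⊇ G p q p≢q a z)
    where
      away : ∀ {z} → ¬ SameEdge a z p q
      away (inj₁ (a≡p , _)) = a≢p a≡p
      away (inj₂ (a≡q , _)) = a≢q a≡q

  internalCount-mono : {G H : Graph n} → (∀ c → 2 ≤ deg H c → 2 ≤ deg G c) →
                       internalCount H ≤ internalCount G
  internalCount-mono {G} {H} H⇒G = countᵇ-mono internal (allFin n)
    where
      internal : ∀ c → (2 ≤ᵇ deg H c) ≡ true → (2 ≤ᵇ deg G c) ≡ true
      internal c e = Equivalence.to T-≡ (≤⇒≤ᵇ (H⇒G c (≤ᵇ⇒≤ 2 (deg H c) (Equivalence.from T-≡ e))))

  adjWithout⇒removeEdge : (G : Graph n) (p q : Fin n) →
                          ∀ a b → adjWithout G p q a b ≡ true → adj (removeEdge G p q) a b ≡ true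
  adjWithout⇒removeEdge G p q a b e = removeEdge-keeps G p q (proj₁ kept) (proj₂ kept)
    where
      kept : adj G a b ≡ true × ¬ SameEdge a b p q
      kept with a ≟ p | b ≟ q | a ≟ q | b ≟ p
      ... | yes _   | yes _   | _       | _       = contradiction e λ ()
      ... | yes _   | no b≢q  | yes _   | yes _   = contradiction e λ ()
      ... | yes _   | no b≢q  | yes _   | no b≢p  = e , [ b≢q ∘ proj₂ , b≢p ∘ proj₂ ]
      ... | yes _   | no b≢q  | no a≢q  | _       = e , [ b≢q ∘ proj₂ , a≢q ∘ proj₁ ]
      ... | no a≢p  | _       | yes _   | yes _   = contradiction e λ ()
      ... | no a≢p  | _       | yes _   | no b≢p  = e , [ a≢p ∘ proj₁ , b≢p ∘ proj₂ ]
      ... | no a≢p  | _       | no a≢q  | _       = e , [ a≢p ∘ proj₁ , a≢q ∘ proj₁ ]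

  module _ {R : Fin n → Fin n → Bool} where

    _++ʷ_ : ∀ {a b c} → Walk R a b → Walk R b c → Walk R a c
    here      ++ʷ w′ = w′
    step ab w ++ʷ w′ = step ab (w ++ʷ w′)

    reverseʷ : (∀ a b → R a b ≡ R b a) → ∀ {a b} → Walk R a b → Walk R b a
    reverseʷ R-sym here                = here
    reverseʷ R-sym (step {a} {b} ab w) = reverseʷ R-sym w ++ʷ step (trans (R-sym b a) ab) here

    walk-invariant : (s : Fin n → Bool) → (∀ a b → R a b ≡ true → s a ≡ s b) →
                     ∀ {a b} → Walk R a b → s a ≡ s b
    walk-invariant s s-edge here                = refl
    walk-invariant s s-edge (step {a} {b} ab w) = trans (s-edge a b ab) (walk-invariant s s-edge w)

    walk-crossing : (s : Fin n → Bool) → ∀ {a b} → Walk R a b → s a ≡ true → s b ≡ false →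
                    ∃₂ λ x y → R x y ≡ true × s x ≡ true × s y ≡ false
    walk-crossing s here                sa sb = contradiction (trans (sym sa) sb) λ ()
    walk-crossing s (step {a} {c} ac w) sa sb with s c in sc
    ... | true  = walk-crossing s w sc sb
    ... | false = a , c , ac , sa , sc

    linked⇒walk : ∀ {a b xs} → Linked (λ x y → R x y ≡ true) (a ∷ xs) → last (a ∷ xs) ≡ just b →
                  Walk R a b
    linked⇒walk {xs = []}    [-]       refl = here
    linked⇒walk {xs = _ ∷ _} (ab ∷ ls) e    = step ab (linked⇒walk ls e)

  mapʷ : ∀ {R R′ : Fin n → Fin n → Bool} → (∀ a b → R a b ≡ true → R′ a b ≡ true) →
         ∀ {a b} → Walk R a b → Walk R′ a b
  mapʷ R⇒R′ here                = here
  mapʷ R⇒R′ (step {a} {b} ab w) = step (R⇒R′ a b ab) (mapʷ R⇒R′ w)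

  connected-via : (G : Graph n) {p q : Fin n} → (∀ z → Walk (adj G) z p ⊎ Walk (adj G) z q) →
                  Walk (adj G) p q → Connected G
  connected-via G {p} {q} to-p-or-q pq a b = to-p a ++ʷ reverseʷ (Graph.sym G) (to-p b)
    where
      to-p : ∀ z → Walk (adj G) z p
      to-p z = [ (λ zp → zp) , (_++ʷ reverseʷ (Graph.sym G) pq) ] (to-p-or-q z)

  walk-removeEdge : (G : Graph n) (p q : Fin n) → ∀ {a b} → Walk (adj G) a b →
                    let R = adj (removeEdge G p q) in Walk R a b ⊎ (Walk R a p ⊎ Walk R a q)
  walk-removeEdge G p q here = inj₁ here
  walk-removeEdge G p q (step {a} {c} ac w) with sameEdge? a c p q
  ... | yes (inj₁ (refl , _)) = inj₂ (inj₁ here)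
  ... | yes (inj₂ (refl , _)) = inj₂ (inj₂ here)
  ... | no ¬e = Data.Sum.map (step ac′) (Data.Sum.map (step ac′) (step ac′)) (walk-removeEdge G p q w)
    where
      ac′ : adj (removeEdge G p q) a c ≡ true
      ac′ = removeEdge-keeps G p q ac ¬e

  last-∈ : ∀ {a b : Fin n} xs → last (a ∷ xs) ≡ just b → b ∈ a ∷ xs
  last-∈ []       refl = here refl
  last-∈ (_ ∷ xs) e    = there (last-∈ xs e)

  record SimplePath (R : Fin n → Fin n → Bool) (a b : Fin n) : Set where
    field
      inner    : List (Fin n)
      linked   : Linked (λ x y → R x y ≡ true) (a ∷ inner)
      distinct : Unique (a ∷ inner)
      ends     : last (a ∷ inner) ≡ just b

  simplePath⇒walk : ∀ {R a b} → SimplePath R a b → Walk R a b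
  simplePath⇒walk P = linked⇒walk (SimplePath.linked P) (SimplePath.ends P)

  acyclic-⊆ : {G H : Graph n} → H ⊆E G → Acyclic G → Acyclic H
  acyclic-⊆ H⊆G acyclic C = acyclic record
    { x₀ = x₀ ; x₁ = x₁ ; x₂ = x₂ ; rest = rest ; xₖ = xₖ ; isLast = isLast ; distinct = distinct
    ; path = Linked.map (H⊆G _ _) path ; closing = H⊆G xₖ x₀ closing }
    where open Cycle C

  acyclic-edge-separates : {G : Graph n} {u v : Fin n} → Acyclic G → adj G u v ≡ true →
                           ¬ SimplePath (adj (removeEdge G u v)) v u
  acyclic-edge-separates {G} {u} {v} acyclic uv P with P
  ... | record { inner = [] ; ends = refl } = contradiction (trans (sym uv) (irrefl G u)) λ ()
  ... | record { inner = _ ∷ [] ; linked = vu ∷ _ ; ends = refl } =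
    contradiction (trans (sym vu) (removeEdge-removes G u v (inj₂ (refl , refl)))) λ ()
  ... | record { inner = a ∷ b ∷ rest ; linked = linked ; distinct = distinct ; ends = ends } =
    acyclic record
      { x₀ = v ; x₁ = a ; x₂ = b ; rest = rest ; xₖ = u ; isLast = ends ; distinct = distinct
      ; path = Linked.map (removeEdge-⊆ G u v _ _) linked ; closing = uv }

  module _ (F : Graph n) (s : Fin n → Bool) (s-edge : ∀ a b → adj F a b ≡ true → s a ≡ s b)
           {x y : Fin n} (s-cross : s x ≢ s y) where

    private
      x≢y : x ≢ y
      x≢y = s-cross ∘ cong s

      F′ : Graph n
      F′ = addEdge F x y x≢y

      LinkedIn : Graph n → List (Fin n) → Set
      LinkedIn G = Linked (λ a b → adj G a b ≡ true)

      crossing : ∀ {a b} → SameEdge a b x y → s a ≢ s b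
      crossing (inj₁ (refl , refl)) = s-cross
      crossing (inj₂ (refl , refl)) = s-cross ∘ sym

      endpoint : ∀ {a b} → SameEdge a b x y → a ≡ x ⊎ a ≡ y
      endpoint (inj₁ (a≡x , _)) = inj₁ a≡x
      endpoint (inj₂ (a≡y , _)) = inj₂ a≡y

      linked-avoiding : ∀ {p xs} → p ≡ x ⊎ p ≡ y → p ∉ xs → LinkedIn F′ xs → LinkedIn F xs
      linked-avoiding p∈xy p∉ []         = []
      linked-avoiding p∈xy p∉ [-]        = [-]
      linked-avoiding p∈xy p∉ (ab ∷ ls) with addEdge-cases F x y x≢y ab
      ... | inj₁ Fab = Fab ∷ linked-avoiding p∈xy (p∉ ∘ there) ls
      ... | inj₂ (inj₁ (refl , refl)) = contradiction p∈xy [ p∉ ∘ here , p∉ ∘ there ∘ here ]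
      ... | inj₂ (inj₂ (refl , refl)) = contradiction p∈xy [ p∉ ∘ there ∘ here , p∉ ∘ here ]

      s-along : ∀ {a b xs} → LinkedIn F (a ∷ xs) → last (a ∷ xs) ≡ just b → s a ≡ s b
      s-along ls e = walk-invariant s s-edge (linked⇒walk ls e)

      -- a simple path through the new edge changes sides, because it uses that edge at most once
      flat-or-crossing : ∀ {a b xs} → LinkedIn F′ (a ∷ xs) → Unique (a ∷ xs) →
                         last (a ∷ xs) ≡ just b → LinkedIn F (a ∷ xs) ⊎ s a ≢ s b
      flat-or-crossing {xs = []} [-] _ _ = inj₁ [-]
      flat-or-crossing {a} {b} {c ∷ xs} (ac ∷ ls) (a∉ ∷ u) e with addEdge-cases F x y x≢y ac
      ... | inj₂ new = inj₂ λ sa≡sb →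
        crossing new (trans sa≡sb (sym (s-along (linked-avoiding (endpoint new) (All¬⇒¬Any a∉) ls) e)))
      ... | inj₁ Fac with flat-or-crossing ls u e
      ...   | inj₁ flat = inj₁ (Fac ∷ flat)
      ...   | inj₂ sc≢sb = inj₂ (sc≢sb ∘ trans (sym (s-edge a c Fac)))

    addEdge-acyclic : Acyclic F → Acyclic F′
    addEdge-acyclic acyclic record { x₀ = x₀ ; x₁ = x₁ ; x₂ = x₂ ; rest = rest ; xₖ = xₖ ; isLast = isLast
                                   ; distinct = distinct ; path = path ; closing = closing }
      with addEdge-cases F x y x≢y closing
    ... | inj₁ Fₖ₀ with flat-or-crossing path distinct isLast
    ...   | inj₁ flat = acyclic record
      { x₀ = x₀ ; x₁ = x₁ ; x₂ = x₂ ; rest = rest ; xₖ = xₖ ; isLast = isLast ; distinct = distinct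
      ; path = flat ; closing = Fₖ₀ }
    ...   | inj₂ s₀≢sₖ = s₀≢sₖ (sym (s-edge xₖ x₀ Fₖ₀))
    addEdge-acyclic acyclic record { x₀ = x₀ ; x₁ = x₁ ; x₂ = x₂ ; rest = rest ; xₖ = xₖ ; isLast = isLast
                                   ; distinct = x₀∉ ∷ x₁∉ ∷ _ ; path = e₀₁ ∷ ls ; closing = _ }
      | inj₂ new with addEdge-cases F x y x≢y e₀₁
    ... | inj₁ F₀₁ = crossing new (sym (trans (s-edge x₀ x₁ F₀₁) s₁≡sₖ))
      where
        s₁≡sₖ : s x₁ ≡ s xₖ
        s₁≡sₖ = s-along (linked-avoiding (endpoint (SameEdge-swap new)) (All¬⇒¬Any x₀∉) ls) isLast
    ... | inj₂ new₀₁ =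
      All¬⇒¬Any x₁∉ (subst (_∈ x₂ ∷ rest) (SameEdge-other (SameEdge-swap new) new₀₁)
                                          (last-∈ rest isLast))

  Stationary : (ℕ → Fin n → Bool) → ℕ → Set
  Stationary S k = ∀ z → S (suc k) z ≡ true → S k z ≡ true

  module _ (S : ℕ → Fin n → Bool) (S-mono : ∀ k z → S k z ≡ true → S (suc k) z ≡ true) where

    ascending-chain-grows : ∀ m → ∃ (Stationary S) ⊎ m ≤ countᵇ (S m) (allFin n)
    ascending-chain-grows zero = inj₂ z≤n
    ascending-chain-grows (suc m) with ascending-chain-grows m
    ... | inj₁ stationary = inj₁ stationary
    ... | inj₂ m≤count with any? (λ z → (S (suc m) z ≟ᴮ true) ×-dec (S m z ≟ᴮ false))
    ... | yes (z , new , old) = inj₂ (≤-<-trans m≤count (countᵇ-mono-< (S-mono m) old new (∈-allFin z)))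
    ... | no none = inj₁ (m , λ z new → ¬-not λ old → none (z , new , old))

    ascending-chain-stabilises : ∃ (Stationary S)
    ascending-chain-stabilises with ascending-chain-grows (suc n)
    ... | inj₁ stationary = stationary
    ... | inj₂ n<count = contradiction (≤-trans (length-filter (T? ∘ S (suc n)) (allFin n))
                                                (≤-reflexive (length-tabulate (λ i → i))))
                                       (<⇒≱ n<count)

  module Reachability (G : Graph n) (t : Fin n) where

    private
      reachesWithin : ℕ → Fin n → Bool
      neighbourWithin? : (k : ℕ) (z : Fin n) →
                         Dec (∃ λ w → adj G z w ≡ true × reachesWithin k w ≡ true)
      reachesWithin zero    z = does (z ≟ t)
      reachesWithin (suc k) z = reachesWithin k z ∨ does (neighbourWithin? k z)
      neighbourWithin? k z = any? λ w → (adj G z w ≟ᴮ true) ×-dec (reachesWithin k w ≟ᴮ true)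

      reachesWithin-mono : ∀ k z → reachesWithin k z ≡ true → reachesWithin (suc k) z ≡ true
      reachesWithin-mono k z e rewrite e = refl

      reachesWithin-step : ∀ k {z w} → adj G z w ≡ true → reachesWithin k w ≡ true →
                           reachesWithin (suc k) z ≡ true
      reachesWithin-step k {z} {w} zw wk =
        trans (cong (reachesWithin k z ∨_) (dec-true (neighbourWithin? k z) (w , zw , wk))) (∨-zeroʳ _)

      reachesWithin-target : ∀ k → reachesWithin k t ≡ true
      reachesWithin-target zero    = dec-true (t ≟ t) refl
      reachesWithin-target (suc k) = reachesWithin-mono k t (reachesWithin-target k)

      -- the vertices of the path all lie within distance k of t, which makes the path simple
      pathWithin : ∀ k {z} → reachesWithin k z ≡ true →
                   Σ (SimplePath (adj G) z t) λ P →
                     All (λ a → reachesWithin k a ≡ true) (z ∷ SimplePath.inner P)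
      pathWithin zero {z} e with z ≟ t
      ... | yes refl = record { inner = [] ; linked = [-] ; distinct = [] ∷ [] ; ends = refl }
                     , reachesWithin-target zero ∷ []
      pathWithin (suc k) {z} e with reachesWithin k z in old
      ... | true with pathWithin k old
      ...   | P , within = P , All.map (reachesWithin-mono k _) within
      pathWithin (suc k) {z} e | false with does⇒ (neighbourWithin? k z) e
      ... | w , zw , ww with pathWithin k ww
      ...   | P , within = path , reachesWithin-step k zw ww ∷ All.map (reachesWithin-mono k _) within
        where
          open SimplePath P
          path : SimplePath (adj G) z t
          path = record
            { inner    = w ∷ inner
            ; linked   = zw ∷ linked
            ; distinct = All.map (λ { ra refl → contradiction (trans (sym old) ra) λ () }) within ∷ distinct
            ; ends     = ends }

      stationary : ∃ (Stationary reachesWithin)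
      stationary = ascending-chain-stabilises reachesWithin reachesWithin-mono

    reaches : Fin n → Bool
    reaches = reachesWithin (proj₁ stationary)

    reaches-target : reaches t ≡ true
    reaches-target = reachesWithin-target (proj₁ stationary)

    reaches-closed : ∀ {a b} → adj G a b ≡ true → reaches b ≡ true → reaches a ≡ true
    reaches-closed {a} ab rb = proj₂ stationary a (reachesWithin-step (proj₁ stationary) ab rb)

    reaches-edge : ∀ a b → adj G a b ≡ true → reaches a ≡ reaches b
    reaches-edge a b ab = Bool-ext (reaches-closed (trans (Graph.sym G b a) ab)) (reaches-closed ab)

    reaches⇒path : ∀ {z} → reaches z ≡ true → SimplePath (adj G) z t
    reaches⇒path = proj₁ ∘ pathWithin (proj₁ stationary)

module EdgeExchange {n : ℕ} {G T : Graph n} (subcubic : Subcubic G) (T⊆G : T ⊆E G)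
                    (T-connected : Connected T) (T-acyclic : Acyclic T)
                    {u v : Fin n} (uv : adj G u v ≡ true) (du : deg T u ≡ 3) (dv : deg T v ≡ 3) where

  saturated : ∀ {c} → deg T c ≡ 3 → ∀ {z} → adj G c z ≡ true → adj T c z ≡ true
  saturated {c} dc = deg-saturated {G = G} {H = T} T⊆G (≤-trans (subcubic c) (≤-reflexive (sym dc)))

  F : Graph n
  F = removeEdge T u v

  open Reachability F u renaming (reaches to side; reaches-edge to side-edge)

  side-u : side u ≡ true
  side-u = reaches-target

  side-v : side v ≡ false
  side-v with side v in sv
  ... | false = refl
  ... | true  = contradiction (reaches⇒path sv) (acyclic-edge-separates T-acyclic (saturated du uv))

  side-saturated : ∀ {c z} → deg T c ≡ 3 → adj (removeEdge G u v) c z ≡ true → side c ≡ side z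
  side-saturated dc cz =
    side-edge _ _ (removeEdge-keeps T u v (saturated dc (removeEdge-⊆ G u v _ _ cz))
                                          (removeEdge-sound G u v cz))

  -- the search is exhaustive, so the negated IsBridge yields an edge without classical reasoning
  crossing-edge : ¬ IsBridge G u v →
                  ∃₂ λ x y → adj (removeEdge G u v) x y ≡ true × side x ≡ true × side y ≡ false
  crossing-edge not-bridge
    with any? (λ x → any? (λ y → (adj (removeEdge G u v) x y ≟ᴮ true)
                                 ×-dec (side x ≟ᴮ true) ×-dec (side y ≟ᴮ false)))
  ... | yes crossing = crossing
  ... | no none = contradiction (uv , λ w → none (crossing-in w)) not-bridge
    where
      crossing-in : Walk (adjWithout G u v) u v →
                    ∃₂ λ x y → adj (removeEdge G u v) x y ≡ true × side x ≡ true × side y ≡ false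
      crossing-in w = walk-crossing side (mapʷ (adjWithout⇒removeEdge G u v) w) side-u side-v

  module Exchanged {x y : Fin n} (xy : adj (removeEdge G u v) x y ≡ true)
                   (side-x : side x ≡ true) (side-y : side y ≡ false) where

    side-cross : side x ≢ side y
    side-cross sx≡sy = contradiction (trans (sym side-x) (trans sx≡sy side-y)) λ ()

    x≢y : x ≢ y
    x≢y = side-cross ∘ cong side

    x≢u : x ≢ u
    x≢u refl = side-cross (side-saturated du xy)

    y≢v : y ≢ v
    y≢v refl = side-cross (sym (side-saturated dv (trans (Graph.sym (removeEdge G u v) y x) xy)))

    u≢y : u ≢ y
    u≢y u≡y = side-cross (trans side-x (trans (sym side-u) (cong side u≡y)))

    v≢x : v ≢ x
    v≢x v≡x = side-cross (trans (cong side (sym v≡x)) (trans side-v (sym side-y)))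

    T′ : Graph n
    T′ = addEdge F x y x≢y

    T′⊆G : T′ ⊆E G
    T′⊆G a b ab with addEdge-cases F x y x≢y ab
    ... | inj₁ Fab                  = T⊆G a b (removeEdge-⊆ T u v a b Fab)
    ... | inj₂ (inj₁ (refl , refl)) = removeEdge-⊆ G u v x y xy
    ... | inj₂ (inj₂ (refl , refl)) = removeEdge-⊆ G u v y x (trans (Graph.sym (removeEdge G u v) y x) xy)

    T′-contains : ContainsAllBut T T′ u v
    T′-contains a b ab ¬uv = addEdge-⊇ F x y x≢y a b (removeEdge-keeps T u v ab ¬uv)

    T′-connected : Connected T′
    T′-connected = connected-via T′ (λ z → Data.Sum.map lift lift (to-u-or-v z)) u-to-v
      where
        lift : ∀ {a b} → Walk (adj F) a b → Walk (adj T′) a b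
        lift = mapʷ (addEdge-⊇ F x y x≢y)

        to-u-or-v : ∀ z → Walk (adj F) z u ⊎ Walk (adj F) z v
        to-u-or-v z = [ inj₁ , [ inj₁ , inj₂ ]′ ]′ (walk-removeEdge T u v (T-connected z u))

        y-to-v : Walk (adj F) y v
        y-to-v with to-u-or-v y
        ... | inj₁ y-to-u = contradiction side-x≡side-y side-cross
          where
            side-x≡side-y : side x ≡ side y
            side-x≡side-y = trans side-x (trans (sym side-u) (sym (walk-invariant side side-edge y-to-u)))
        ... | inj₂ y-to-v = y-to-v

        u-to-v : Walk (adj T′) u v
        u-to-v = reverseʷ (Graph.sym T′) (lift (simplePath⇒walk (reaches⇒path side-x)))
                 ++ʷ step (addEdge-adds F x y x≢y (inj₁ (refl , refl))) (lift y-to-v)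

    T′-acyclic : Acyclic T′
    T′-acyclic =
      addEdge-acyclic F side side-edge side-cross (acyclic-⊆ (removeEdge-⊆ T u v) T-acyclic)

    deg-T′ : ∀ {c d} → c ≢ x → c ≢ y → adj T c d ≡ true → SameEdge c d u v →
             suc (deg T′ c) ≡ deg T c
    deg-T′ c≢x c≢y cd e =
      trans (cong suc (addEdge-deg-away {G = F} x≢y c≢x c≢y)) (sym (removeEdge-deg {G = T} cd e))

    deg-T′-u : deg T′ u ≡ 2
    deg-T′-u = suc-injective (trans (deg-T′ (x≢u ∘ sym) u≢y (saturated du uv) (inj₁ (refl , refl))) du)

    deg-T′-v : deg T′ v ≡ 2
    deg-T′-v = suc-injective (trans (deg-T′ v≢x (y≢v ∘ sym) vu (inj₂ (refl , refl))) dv)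
      where
        vu : adj T v u ≡ true
        vu = saturated dv (trans (Graph.sym G v u) uv)

    T′-internal : internalCount T ≤ internalCount T′
    T′-internal = internalCount-mono {G = T′} {H = T} internal
      where
        internal : ∀ c → 2 ≤ deg T c → 2 ≤ deg T′ c
        internal c 2≤d = by-cases (c ≟ u) (c ≟ v)
          where
            by-cases : Dec (c ≡ u) → Dec (c ≡ v) → 2 ≤ deg T′ c
            by-cases (yes c≡u) _         = ≤-reflexive (sym (trans (cong (deg T′) c≡u) deg-T′-u))
            by-cases (no _)    (yes c≡v) = ≤-reflexive (sym (trans (cong (deg T′) c≡v) deg-T′-v))
            by-cases (no c≢u)  (no c≢v)  =
              ≤-trans 2≤d (deg-mono {G = T′} {H = T} λ z cz →
                             T′-contains c z cz [ c≢u ∘ proj₁ , c≢v ∘ proj₁ ])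

lemma6 : ∀ {n : ℕ} (G T : Graph n) → Subcubic G → IsSpanningTree G T →
    (u v : Fin n) → deg T v ≡ 3 → adj G u v ≡ true → deg T u ≡ 3 →
    ¬ IsBridge G u v →
    Σ (Graph n) λ T' → IsSpanningTree G T' × ContainsAllBut T T' u v ×
      internalCount T ≤ internalCount T' × deg T' u ≡ 2 × deg T' v ≡ 2
lemma6 G T subcubic (T⊆G , T-connected , T-acyclic) u v dv uv du not-bridge =
  let open EdgeExchange subcubic T⊆G T-connected T-acyclic uv du dv
      (x , y , xy , side-x , side-y) = crossing-edge not-bridge
      open Exchanged xy side-x side-y
  in T′ , (T′⊆G , T′-connected , T′-acyclic) , T′-contains , T′-internal , deg-T′-u , deg-T′-v
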